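{- For every positive integer $n$, the quotients $H^{**}(n)/H_5(n)$, $H_4(n)/H_2(n)$ and $H_6(n)/H^*(n)$ are integers. If $n=p_1^{\varepsilon_1}\cdots p_r^{\varepsilon_r}$ with distinct primes $p_i$ and $\varepsilon_i\in\{1,2\}$, then $H_3(n)=H_1(n)$, $H_5(n)=H^*(n)$, $H_6(n)=H^{**}(n)=H^*(n)$ and $H_4(n)=H_2(n)$. If $n=p_1^{a_1}\cdots p_r^{a_r}$ with all $a_i$ odd, then $H_5(n)=H_2(n)$, $H_6(n)=H_1(n)$ and $H_3(n)=H_4(n)=H(n)$.
   Context: $\sigma(n)$, $d(n)$: sum and number of positive divisors of $n$. A divisor $d$ of $n$ is unitary if $\gcd(d,n/d)=1$; $\sigma^*(n)$, $d^*(n)$: sum and number of unitary divisors. A divisor $d$ of $n$ is bi-unitary if the greatest common unitary divisor of $d$ and $n/d$ is $1$; $\sigma^{**}(n)$, $d^{**}(n)$: sum and number of bi-unitary divisors. Define $H(n)=\frac{nd(n)}{\sigma(n)}$, $H^*(n)=\frac{nd^*(n)}{\sigma^*(n)}$, $H^{**}(n)=\frac{nd^{**}(n)}{\sigma^{**}(n)}$, $H_1(n)=\frac{nd(n)}{\sigma^*(n)}$, $H_2(n)=\frac{nd^*(n)}{\sigma(n)}$, $H_3(n)=\frac{nd(n)}{\sigma^{**}(n)}$, $H_4(n)=\frac{nd^{**}(n)}{\sigma(n)}$, $H_5(n)=\frac{nd^*(n)}{\sigma^{**}(n)}$, $H_6(n)=\frac{nd^{**}(n)}{\sigma^*(n)}$.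 -}

module Defs where

open import Data.Nat using (ℕ; zero; suc; _+_; _*_; _^_; _⊔_; _≟_; _%_)
open import Data.Nat.DivMod using (_/_)
open import Data.Nat.Divisibility using (_∣_; _∣?_)
open import Data.Nat.GCD using (gcd)
open import Data.Nat.ListAction using (sum; product)
open import Data.Nat.Primality using (Prime)
open import Data.List using (List; filter; map; length; upTo; foldr)
open import Data.List.Relation.Unary.All using (All)
open import Data.List.Relation.Unary.Unique.Propositional using (Unique)
open import Data.Product using (_×_; _,_; proj₁; proj₂)
open import Data.Sum using (_⊎_)
open import Data.Integer using (+_)
open import Data.Rational as ℚ using (ℚ; 0ℚ)
open import Relation.Binary.PropositionalEquality using (_≡_)
open import Relation.Nullary.Decidable using (Dec; _×-dec_)

-- n / d, with the (irrelevant) convention n / 0 = 0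
quot : ℕ → ℕ → ℕ
quot n zero    = 0
quot n (suc k) = n / suc k

divisors : ℕ → List ℕ
divisors n = filter (λ d → d ∣? n) (map suc (upTo n))

IsUnitaryDivisor : ℕ → ℕ → Set
IsUnitaryDivisor e m = e ∣ m × gcd e (quot m e) ≡ 1

isUnitaryDivisor? : ∀ e m → Dec (IsUnitaryDivisor e m)
isUnitaryDivisor? e m = (e ∣? m) ×-dec (gcd e (quot m e) ≟ 1)

unitaryDivisors : ℕ → List ℕ
unitaryDivisors n = filter (λ d → isUnitaryDivisor? d n) (divisors n)

commonUnitaryDivisors : ℕ → ℕ → List ℕ
commonUnitaryDivisors a b = filter (λ e → isUnitaryDivisor? e b) (unitaryDivisors a)

gcud : ℕ → ℕ → ℕ
gcud a b = foldr _⊔_ 0 (commonUnitaryDivisors a b)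

biUnitaryDivisors : ℕ → List ℕ
biUnitaryDivisors n = filter (λ d → gcud d (quot n d) ≟ 1) (divisors n)

σ τ σ* τ* σ** τ** : ℕ → ℕ
σ   n = sum (divisors n)
τ   n = length (divisors n)
σ*  n = sum (unitaryDivisors n)
τ*  n = length (unitaryDivisors n)
σ** n = sum (biUnitaryDivisors n)
τ** n = length (biUnitaryDivisors n)

frac : ℕ → ℕ → ℚ
frac a zero    = 0ℚ
frac a (suc b) = (+ a) ℚ./ suc b

H H* H** H₁ H₂ H₃ H₄ H₅ H₆ : ℕ → ℚ
H   n = frac (n * τ n)   (σ n)
H*  n = frac (n * τ* n)  (σ* n)
H** n = frac (n * τ** n) (σ** n)
H₁  n = frac (n * τ n)   (σ* n)
H₂  n = frac (n * τ* n)  (σ n)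
H₃  n = frac (n * τ n)   (σ** n)
H₄  n = frac (n * τ** n) (σ n)
H₅  n = frac (n * τ* n)  (σ** n)
H₆  n = frac (n * τ** n) (σ* n)

IsFactorisation : ℕ → List (ℕ × ℕ) → Set
IsFactorisation n ps =
  All (λ pa → Prime (proj₁ pa)) ps × Unique (map proj₁ ps) ×
  n ≡ product (map (λ pa → proj₁ pa ^ proj₂ pa) ps)

OddNat : ℕ → Set
OddNat a = a % 2 ≡ 1

module Submission where

-- It reduces to three statements about divisor lists:
--   (A) τ* n divides τ** n, so replacing τ* by τ** scales a quotient by an integer;
--   (B) if all exponents of n are 1 or 2, unitary and bi-unitary divisors coincide;
--   (C) if all exponents of n are odd, every divisor is bi-unitary.
-- All three are local in the primes. For n = p ^ a * m with p ∤ m, every factor pair (d, r) of n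
-- splits as d = p ^ i * e, r = p ^ l * h with a = i + l and m = e * h (FactorPairSplit), and:
--   d, r coprime            ⇔ i = 0 or l = 0, and e, h coprime                (coprime-local)
--   d, r unitarily coprime  ⇔ not (i = l ≥ 1), and e, h unitarily coprime    (unitarilyCoprime-local)
-- Counting the pairs (i, e) gives τ*(p ^ a * m) = 2 τ*(m) and τ**(p ^ a * m) = |offCentre a| τ**(m),
-- where offCentre a = {i ≤ a | 2 i ≠ a} has even size; (A) follows by induction along prime-power
-- splittings. (B) and (C) follow by induction along the given factorisation, since for a ≤ 2,
-- resp. odd a, the two local conditions on (i, l) agree, resp. "not (i = l ≥ 1)" always holds.

open import Defs

module DivisorTheory where

  open import Data.Nat
  open import Data.Nat.Properties
  open import Data.Nat.Divisibility
  open import Data.Nat.Coprimality as Coprimality using (Coprime; coprime-divisor)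
  open import Data.Nat.Primality using (Prime; prime⇒nonZero; prime⇒nonTrivial; prime⇒irreducible; euclidsLemma)
  open import Data.Nat.Primality.Factorisation using (factorise)
  open import Data.Nat.ListAction using (product)
  open import Data.Nat.Induction using (<-rec)
  open import Data.Nat.DivMod using (_/_; m*n/n≡m; m≡m%n+[m/n]*n; m%n<n; m*n%n≡0)
  open import Data.Nat.GCD using (gcd)
  open import Data.List using (List; []; _∷_; _++_; map; filter; upTo; foldr; length; cartesianProduct)
  open import Data.List.Properties using (length-++; length-map; length-upTo; filter-all; filter-accept; filter-reject; filter-≐)
  open import Data.List.Membership.Propositional using (_∈_)
  open import Data.List.Membership.Propositional.Properties
    using (∈-filter⁺; ∈-filter⁻; ∈-map⁺; ∈-map⁻; ∈-upTo⁺; ∈-upTo⁻; ∈-∃++; ∈-++⁺ˡ; ∈-++⁺ʳ; ∈-++⁻;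
           ∈-cartesianProduct⁺; ∈-cartesianProduct⁻)
  import Data.List.Relation.Unary.AllPairs as AllPairs
  open import Data.List.Relation.Unary.All as All using (All; []; _∷_)
  open import Data.List.Relation.Unary.Any using (here; there)
  open import Data.List.Relation.Unary.Unique.Propositional using (Unique)
  import Data.List.Relation.Unary.Unique.Propositional.Properties as Unique
  open import Data.Product hiding (map)
  open import Data.Sum using (_⊎_; inj₁; inj₂)
  open import Function using (_∘_; _⇔_; mk⇔; Equivalence)
  open import Relation.Nullary using (¬_; ¬?; yes; no; contradiction)
  open import Relation.Binary.PropositionalEquality
  open import Relation.Unary using (_≐_; Decidable)

  factors-positive : ∀ {n} d r → 1 ≤ n → n ≡ d * r → 1 ≤ d × 1 ≤ r
  factors-positive zero    r       1≤n refl = contradiction 1≤n λ ()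
  factors-positive (suc d) zero    1≤n refl = contradiction (subst (1 ≤_) (*-zeroʳ d) 1≤n) λ ()
  factors-positive (suc _) (suc _) _   _    = s≤s z≤n , s≤s z≤n

  prime≥2 : ∀ {p} → Prime p → 2 ≤ p
  prime≥2 {p} p-prime = nonTrivial⇒n>1 p {{prime⇒nonTrivial p-prime}}

  prime^-positive : ∀ {p} → Prime p → ∀ i → 1 ≤ p ^ i
  prime^-positive {p} p-prime = m^n>0 p {{prime⇒nonZero p-prime}}

  prime^≥2 : ∀ {p} → Prime p → ∀ i → 1 ≤ i → 2 ≤ p ^ i
  prime^≥2 p-prime (suc i) _ = *-mono-≤ (prime≥2 p-prime) (prime^-positive p-prime i)

  coprime-1ˡ : ∀ x → Coprime 1 x
  coprime-1ˡ x (d∣1 , _) = ∣1⇒≡1 d∣1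

  coprime-*ˡ : ∀ {a b c} → Coprime a c → Coprime b c → Coprime (a * b) c
  coprime-*ˡ {a} {b} {c} a⊥c b⊥c {d} (d∣ab , d∣c) = b⊥c (coprime-divisor d⊥a d∣ab , d∣c)
    where
    d⊥a : Coprime d a
    d⊥a (e∣d , e∣a) = a⊥c (e∣a , ∣-trans e∣d d∣c)

  coprime-*ʳ : ∀ {a b c} → Coprime a b → Coprime a c → Coprime a (b * c)
  coprime-*ʳ a⊥b a⊥c = Coprimality.sym (coprime-*ˡ (Coprimality.sym a⊥b) (Coprimality.sym a⊥c))

  prime^-coprime : ∀ {p e} → Prime p → ¬ p ∣ e → ∀ i → Coprime (p ^ i) e
  prime^-coprime p-prime p∤e zero = coprime-1ˡ _
  prime^-coprime p-prime p∤e (suc i) = coprime-*ˡ p⊥e (prime^-coprime p-prime p∤e i)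
    where
    p⊥e : Coprime _ _
    p⊥e (d∣p , d∣e) with prime⇒irreducible p-prime d∣p
    ... | inj₁ d≡1 = d≡1
    ... | inj₂ refl = contradiction d∣e p∤e

  prime∤* : ∀ {p g u} → Prime p → ¬ p ∣ g → ¬ p ∣ u → ¬ p ∣ g * u
  prime∤* {g = g} {u} p-prime p∤g p∤u p∣gu with euclidsLemma g u p-prime p∣gu
  ... | inj₁ p∣g = p∤g p∣g
  ... | inj₂ p∣u = p∤u p∣u

  record PPart (p x : ℕ) : Set where
    constructor pPart
    field
      exponent rest : ℕ
      x≡ : x ≡ p ^ exponent * rest
      p∤rest : ¬ p ∣ rest

  pPart-exists : ∀ {p} → Prime p → ∀ x → 1 ≤ x → PPart p x
  pPart-exists {p} p-prime = <-rec (λ x → 1 ≤ x → PPart p x) step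
    where
    step : ∀ x → (∀ {y} → y < x → 1 ≤ y → PPart p y) → 1 ≤ x → PPart p x
    step x rec 1≤x with p ∣? x
    ... | no p∤x = pPart 0 x (sym (*-identityˡ x)) p∤x
    ... | yes (divides q x≡q*p) = pPart (suc i) e x≡ p∤e
      where
      1≤q : 1 ≤ q
      1≤q = proj₁ (factors-positive q p 1≤x x≡q*p)
      q<x : q < x
      q<x = subst (q <_) (sym x≡q*p) (m<m*n q p {{>-nonZero 1≤q}} (prime≥2 p-prime))
      open PPart (rec q<x 1≤q) renaming (exponent to i; rest to e; x≡ to q≡; p∤rest to p∤e)
      x≡ : x ≡ p * p ^ i * e
      x≡ = begin
        x               ≡⟨ x≡q*p ⟩
        q * p           ≡⟨ *-comm q p ⟩
        p * q           ≡⟨ cong (p *_) q≡ ⟩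
        p * (p ^ i * e) ≡⟨ *-assoc p (p ^ i) e ⟨
        p * p ^ i * e   ∎
        where open ≡-Reasoning

  p∣p^suc* : ∀ p j y → p ∣ p ^ suc j * y
  p∣p^suc* p j y = ∣-trans (m∣m*n (p ^ j)) (m∣m*n y)

  pPart-unique : ∀ {p} → Prime p → ∀ i j {e f} → ¬ p ∣ e → ¬ p ∣ f →
                 p ^ i * e ≡ p ^ j * f → i ≡ j × e ≡ f
  pPart-unique p-prime zero zero {e} {f} _ _ eq = refl , trans (sym (*-identityˡ e)) (trans eq (*-identityˡ f))
  pPart-unique {p} p-prime zero (suc j) {e} {f} p∤e _ eq =
    contradiction (subst (p ∣_) (trans (sym eq) (*-identityˡ e)) (p∣p^suc* p j f)) p∤e
  pPart-unique p-prime (suc i) zero p∤e p∤f eq =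
    Data.Product.map sym sym (pPart-unique p-prime zero (suc i) p∤f p∤e (sym eq))
  pPart-unique {p} p-prime (suc i) (suc j) {e} {f} p∤e p∤f eq
    with pPart-unique p-prime i j p∤e p∤f (*-cancelˡ-≡ _ _ p {{prime⇒nonZero p-prime}}
           (trans (sym (*-assoc p (p ^ i) e)) (trans eq (*-assoc p (p ^ j) f))))
  ... | refl , e≡f = refl , e≡f

  p^*-regroup : ∀ p i l e h → p ^ i * e * (p ^ l * h) ≡ p ^ (i + l) * (e * h)
  p^*-regroup p i l e h = begin
    p ^ i * e * (p ^ l * h)   ≡⟨ [m*n]*[o*p]≡[m*o]*[n*p] (p ^ i) e (p ^ l) h ⟩
    p ^ i * p ^ l * (e * h)   ≡⟨ cong (_* (e * h)) (^-distribˡ-+-* p i l) ⟨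
    p ^ (i + l) * (e * h)     ∎
    where open ≡-Reasoning

  p^*-split : ∀ p i l e h {a m} → a ≡ i + l → m ≡ e * h → p ^ a * m ≡ p ^ i * e * (p ^ l * h)
  p^*-split p i l e h refl refl = sym (p^*-regroup p i l e h)

  record FactorPairSplit (p a m d r : ℕ) : Set where
    field
      i l e h : ℕ
      d≡ : d ≡ p ^ i * e
      r≡ : r ≡ p ^ l * h
      a≡ : a ≡ i + l
      m≡ : m ≡ e * h
      p∤e : ¬ p ∣ e
      p∤h : ¬ p ∣ h
      1≤e : 1 ≤ e
      1≤h : 1 ≤ h

  -- Obtained from the p-parts of d and r and uniqueness of the p-part of p ^ a * m.
  splitFactorPair : ∀ {p a m d r} → Prime p → ¬ p ∣ m → 1 ≤ m →
                    p ^ a * m ≡ d * r → FactorPairSplit p a m d r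
  splitFactorPair {p} {a} {m} {d} {r} p-prime p∤m 1≤m eq = record
    { i = i ; l = l ; e = e ; h = h ; d≡ = d≡ ; r≡ = r≡
    ; a≡ = proj₁ unique ; m≡ = proj₂ unique ; p∤e = p∤e ; p∤h = p∤h
    ; 1≤e = proj₁ (factors-positive e h 1≤m (proj₂ unique)) ; 1≤h = proj₂ (factors-positive e h 1≤m (proj₂ unique)) }
    where
    positive : 1 ≤ d × 1 ≤ r
    positive = factors-positive d r (*-mono-≤ (prime^-positive p-prime a) 1≤m) eq
    open PPart (pPart-exists p-prime d (proj₁ positive)) renaming (exponent to i; rest to e; x≡ to d≡; p∤rest to p∤e)
    open PPart (pPart-exists p-prime r (proj₂ positive)) renaming (exponent to l; rest to h; x≡ to r≡; p∤rest to p∤h)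
    unique : a ≡ i + l × m ≡ e * h
    unique = pPart-unique p-prime a (i + l) p∤m (prime∤* p-prime p∤e p∤h)
               (trans eq (trans (cong₂ _*_ d≡ r≡) (p^*-regroup p i l e h)))

  coprime-local⇒ : ∀ {p e h} → Prime p → ∀ i l → Coprime (p ^ i * e) (p ^ l * h) →
                   (i ≡ 0 ⊎ l ≡ 0) × Coprime e h
  coprime-local⇒ {p} {e} {h} p-prime i l coprime = exponent-vanishes i l coprime , e⊥h
    where
    e⊥h : Coprime e h
    e⊥h (d∣e , d∣h) = coprime (∣n⇒∣m*n (p ^ i) d∣e , ∣n⇒∣m*n (p ^ l) d∣h)
    exponent-vanishes : ∀ i l → Coprime (p ^ i * e) (p ^ l * h) → i ≡ 0 ⊎ l ≡ 0
    exponent-vanishes zero    l       _ = inj₁ refl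
    exponent-vanishes (suc i) zero    _ = inj₂ refl
    exponent-vanishes (suc i) (suc l) c =
      contradiction (c (p∣p^suc* p i e , p∣p^suc* p l h)) (>⇒≢ (prime≥2 p-prime))

  coprime-local⇐ : ∀ {p e h} → Prime p → ¬ p ∣ e → ¬ p ∣ h → ∀ i l →
                   (i ≡ 0 ⊎ l ≡ 0) → Coprime e h → Coprime (p ^ i * e) (p ^ l * h)
  coprime-local⇐ {p} {e} {h} p-prime p∤e p∤h i l vanishes e⊥h = coprime-*ˡ (power-part i l vanishes) e-part
    where
    power-part : ∀ i l → (i ≡ 0 ⊎ l ≡ 0) → Coprime (p ^ i) (p ^ l * h)
    power-part .0 l    (inj₁ refl) = coprime-1ˡ _
    power-part i  .0   (inj₂ refl) = coprime-*ʳ (Coprimality.sym (coprime-1ˡ _)) (prime^-coprime p-prime p∤h i)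
    e-part : Coprime e (p ^ l * h)
    e-part = coprime-*ʳ (Coprimality.sym (prime^-coprime p-prime p∤e l)) e⊥h

  UnitaryDivisor : ℕ → ℕ → Set
  UnitaryDivisor f x = Σ ℕ λ q → x ≡ f * q × Coprime f q

  1-unitaryDivisor : ∀ x → UnitaryDivisor 1 x
  1-unitaryDivisor x = x , sym (*-identityˡ x) , coprime-1ˡ x

  UnitarilyCoprime : ℕ → ℕ → Set
  UnitarilyCoprime d r = ∀ f → UnitaryDivisor f d → UnitaryDivisor f r → f ≤ 1

  1-unitarilyCoprime : ∀ r → UnitarilyCoprime 1 r
  1-unitarilyCoprime r f (q , 1≡ , _) _ = ≤-reflexive (m*n≡1⇒m≡1 f q (sym 1≡))

  ∤-divisor : ∀ {p e g} → ¬ p ∣ e → ∀ u → e ≡ g * u → ¬ p ∣ g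
  ∤-divisor p∤e u e≡ p∣g = p∤e (subst (_ ∣_) (sym e≡) (∣-trans p∣g (m∣m*n u)))

  unitaryDivisor-∤ : ∀ {p g x} → UnitaryDivisor g x → ¬ p ∣ x → ¬ p ∣ g
  unitaryDivisor-∤ (u , x≡ , _) p∤x = ∤-divisor p∤x u x≡

  unitaryDivisor-local⇒ : ∀ {p i e f} → Prime p → ¬ p ∣ e → 1 ≤ e → UnitaryDivisor f (p ^ i * e) →
                          Σ ℕ λ k → Σ ℕ λ g → f ≡ p ^ k * g × (k ≡ 0 ⊎ k ≡ i) × UnitaryDivisor g e
  unitaryDivisor-local⇒ {p} {i} {e} {f} p-prime p∤e 1≤e (q , x≡ , f⊥q) =
    S.i , S.e , S.d≡ , exponent-choice (proj₁ local) , S.h , S.m≡ , proj₂ local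
    where
    module S = FactorPairSplit (splitFactorPair {a = i} {d = f} {r = q} p-prime p∤e 1≤e x≡)
    local = coprime-local⇒ p-prime S.i S.l (subst₂ Coprime S.d≡ S.r≡ f⊥q)
    exponent-choice : S.i ≡ 0 ⊎ S.l ≡ 0 → S.i ≡ 0 ⊎ S.i ≡ i
    exponent-choice (inj₁ k≡0) = inj₁ k≡0
    exponent-choice (inj₂ l≡0) = inj₂ (sym (trans S.a≡ (trans (cong (S.i +_) l≡0) (+-identityʳ S.i))))

  complementary-exponent : ∀ {k i} → k ≡ 0 ⊎ k ≡ i → Σ ℕ λ l → i ≡ k + l × (k ≡ 0 ⊎ l ≡ 0)
  complementary-exponent {i = i} (inj₁ refl) = i , refl , inj₁ refl
  complementary-exponent {k}     (inj₂ refl) = 0 , sym (+-identityʳ k) , inj₂ refl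

  unitaryDivisor-local⇐ : ∀ {p e k g} → Prime p → ¬ p ∣ e → ∀ i → (k ≡ 0 ⊎ k ≡ i) →
                          UnitaryDivisor g e → UnitaryDivisor (p ^ k * g) (p ^ i * e)
  unitaryDivisor-local⇐ {p} {e} {k} {g} p-prime p∤e i k-choice (u , e≡ , g⊥u)
    with l , i≡ , vanishes ← complementary-exponent k-choice =
    p ^ l * u , p^*-split p k l g u i≡ e≡ ,
    coprime-local⇐ p-prime (∤-divisor p∤e u e≡) (∤-divisor p∤e g (trans e≡ (*-comm g u))) k l vanishes g⊥u

  -- The exponents i, l of p in d = p ^ i * e and r = p ^ l * h coincide and are positive,
  -- which is exactly when p ^ i is a common unitary divisor of d and r.
  SharedPPower : ℕ → ℕ → Set
  SharedPPower i l = i ≡ l × 1 ≤ i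

  common-exponent≡0 : ∀ {k i l} → (k ≡ 0 ⊎ k ≡ i) → (k ≡ 0 ⊎ k ≡ l) → ¬ SharedPPower i l → k ≡ 0
  common-exponent≡0         (inj₁ k≡0)  _           _ = k≡0
  common-exponent≡0         (inj₂ _)    (inj₁ k≡0)  _ = k≡0
  common-exponent≡0 {zero}  (inj₂ _)    (inj₂ _)    _ = refl
  common-exponent≡0 {suc k} (inj₂ refl) (inj₂ refl) ¬shared = contradiction (refl , s≤s z≤n) ¬shared

  unitarilyCoprime-local⇐ : ∀ {p e h} → Prime p → ¬ p ∣ e → ¬ p ∣ h → 1 ≤ e → 1 ≤ h → ∀ i l →
                            ¬ SharedPPower i l → UnitarilyCoprime e h →
                            UnitarilyCoprime (p ^ i * e) (p ^ l * h)
  unitarilyCoprime-local⇐ {p} {e} {h} p-prime p∤e p∤h 1≤e 1≤h i l ¬shared e⊥⊥h f f∣∣d f∣∣r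
    with unitaryDivisor-local⇒ p-prime p∤e 1≤e f∣∣d | unitaryDivisor-local⇒ p-prime p∤h 1≤h f∣∣r
  ... | k , g , f≡ , k-choice , g∣∣e | k′ , g′ , f≡′ , k′-choice , g′∣∣h
    with pPart-unique p-prime k k′ (unitaryDivisor-∤ g∣∣e p∤e) (unitaryDivisor-∤ g′∣∣h p∤h) (trans (sym f≡) f≡′)
  ... | refl , refl = begin
    f           ≡⟨ f≡ ⟩
    p ^ k * g   ≡⟨ cong (λ k → p ^ k * g) (common-exponent≡0 k-choice k′-choice ¬shared) ⟩
    1 * g       ≡⟨ *-identityˡ g ⟩
    g           ≤⟨ e⊥⊥h g g∣∣e g′∣∣h ⟩
    1           ∎
    where open ≤-Reasoning

  unitarilyCoprime-local⇒ : ∀ {p e h} → Prime p → ¬ p ∣ e → ¬ p ∣ h → ∀ i l →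
                            UnitarilyCoprime (p ^ i * e) (p ^ l * h) →
                            ¬ SharedPPower i l × UnitarilyCoprime e h
  unitarilyCoprime-local⇒ {p} {e} {h} p-prime p∤e p∤h i l d⊥⊥r = not-shared , e⊥⊥h
    where
    -- otherwise p ^ i would be a common unitary divisor exceeding 1
    not-shared : ¬ SharedPPower i l
    not-shared (refl , 1≤i) = <⇒≱ (prime^≥2 p-prime i 1≤i) (begin
      p ^ i      ≡⟨ *-identityʳ (p ^ i) ⟨
      p ^ i * 1  ≤⟨ d⊥⊥r (p ^ i * 1) (unitaryDivisor-local⇐ p-prime p∤e i (inj₂ refl) (1-unitaryDivisor e))
                                     (unitaryDivisor-local⇐ p-prime p∤h i (inj₂ refl) (1-unitaryDivisor h)) ⟩
      1          ∎)
      where open ≤-Reasoning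
    e⊥⊥h : UnitarilyCoprime e h
    e⊥⊥h g g∣∣e g∣∣h = subst (_≤ 1) (*-identityˡ g)
      (d⊥⊥r (1 * g) (unitaryDivisor-local⇐ p-prime p∤e i (inj₁ refl) g∣∣e)
                    (unitaryDivisor-local⇐ p-prime p∤h l (inj₁ refl) g∣∣h))

  ∣⇒≡*quot : ∀ {d n} → 1 ≤ n → d ∣ n → n ≡ d * quot n d
  ∣⇒≡*quot {zero}  1≤n 0∣n = contradiction (0∣⇒≡0 0∣n) (n>0⇒n≢0 1≤n)
  ∣⇒≡*quot {suc d} _   d∣n = trans (m∣n⇒n≡m*quotient d∣n) (cong (suc d *_) (sym (n/m≡quotient d∣n)))

  quot-exact : ∀ e {m h} → 1 ≤ e → m ≡ e * h → quot m e ≡ h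
  quot-exact (suc e) {h = h} _ refl = trans (cong (_/ suc e) (*-comm (suc e) h)) (m*n/n≡m h (suc e))

  ∈-divisors⁺ : ∀ {d n} → 1 ≤ n → d ∣ n → d ∈ divisors n
  ∈-divisors⁺ {zero}  1≤n 0∣n = contradiction (0∣⇒≡0 0∣n) (n>0⇒n≢0 1≤n)
  ∈-divisors⁺ {suc d} {n} 1≤n d∣n =
    ∈-filter⁺ (_∣? n) (∈-map⁺ suc (∈-upTo⁺ (∣⇒≤ {{>-nonZero 1≤n}} d∣n))) d∣n

  ∈-divisors⁻ : ∀ {d n} → d ∈ divisors n → d ∣ n
  ∈-divisors⁻ {n = n} d∈ = proj₂ (∈-filter⁻ (_∣? n) {xs = map suc (upTo n)} d∈)

  divisors-unique : ∀ n → Unique (divisors n)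
  divisors-unique n = Unique.filter⁺ (_∣? n) (Unique.map⁺ suc-injective (Unique.upTo⁺ n))

  isUnitaryDivisor⇒ : ∀ {f x} → 1 ≤ x → IsUnitaryDivisor f x → UnitaryDivisor f x
  isUnitaryDivisor⇒ 1≤x (f∣x , gcd≡1) = _ , ∣⇒≡*quot 1≤x f∣x , Coprimality.gcd≡1⇒coprime gcd≡1

  isUnitaryDivisor⇐ : ∀ {f x} → 1 ≤ x → UnitaryDivisor f x → IsUnitaryDivisor f x
  isUnitaryDivisor⇐ {f} 1≤x (q , x≡ , f⊥q) =
    divides q (trans x≡ (*-comm f q)) ,
    trans (cong (gcd f) (quot-exact f (proj₁ (factors-positive f q 1≤x x≡)) x≡)) (Coprimality.coprime⇒gcd≡1 f⊥q)

  ∈-unitaryDivisors⁺ : ∀ {f x} → 1 ≤ x → UnitaryDivisor f x → f ∈ unitaryDivisors x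
  ∈-unitaryDivisors⁺ {x = x} 1≤x f∣∣x =
    ∈-filter⁺ (λ d → isUnitaryDivisor? d x) (∈-divisors⁺ 1≤x (proj₁ unitary)) unitary
    where unitary = isUnitaryDivisor⇐ 1≤x f∣∣x

  ∈-unitaryDivisors⁻ : ∀ {f x} → 1 ≤ x → f ∈ unitaryDivisors x → UnitaryDivisor f x
  ∈-unitaryDivisors⁻ {x = x} 1≤x f∈ =
    isUnitaryDivisor⇒ 1≤x (proj₂ (∈-filter⁻ (λ d → isUnitaryDivisor? d x) {xs = divisors x} f∈))

  unitaryDivisors-unique : ∀ n → Unique (unitaryDivisors n)
  unitaryDivisors-unique n = Unique.filter⁺ (λ d → isUnitaryDivisor? d n) (divisors-unique n)

  ≤-foldr-⊔ : ∀ {x xs} → x ∈ xs → x ≤ foldr _⊔_ 0 xs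
  ≤-foldr-⊔ {xs = y ∷ _} (here refl) = m≤m⊔n y _
  ≤-foldr-⊔ {xs = y ∷ _} (there x∈)  = ≤-trans (≤-foldr-⊔ x∈) (m≤n⊔m y _)

  foldr-⊔-≤ : ∀ {k xs} → All (_≤ k) xs → foldr _⊔_ 0 xs ≤ k
  foldr-⊔-≤ []         = z≤n
  foldr-⊔-≤ (x≤k ∷ xs≤k) = ⊔-lub x≤k (foldr-⊔-≤ xs≤k)

  ∈-commonUnitaryDivisors⁺ : ∀ {f d r} → 1 ≤ d → 1 ≤ r → UnitaryDivisor f d → UnitaryDivisor f r →
                             f ∈ commonUnitaryDivisors d r
  ∈-commonUnitaryDivisors⁺ {r = r} 1≤d 1≤r f∣∣d f∣∣r =
    ∈-filter⁺ (λ e → isUnitaryDivisor? e r) (∈-unitaryDivisors⁺ 1≤d f∣∣d) (isUnitaryDivisor⇐ 1≤r f∣∣r)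

  ∈-commonUnitaryDivisors⁻ : ∀ {f d r} → 1 ≤ d → 1 ≤ r → f ∈ commonUnitaryDivisors d r →
                             UnitaryDivisor f d × UnitaryDivisor f r
  ∈-commonUnitaryDivisors⁻ {d = d} {r} 1≤d 1≤r f∈ =
    let f∈d , f∣∣r = ∈-filter⁻ (λ e → isUnitaryDivisor? e r) {xs = unitaryDivisors d} f∈
    in ∈-unitaryDivisors⁻ 1≤d f∈d , isUnitaryDivisor⇒ 1≤r f∣∣r

  gcud≡1⇒unitarilyCoprime : ∀ {d r} → 1 ≤ d → 1 ≤ r → gcud d r ≡ 1 → UnitarilyCoprime d r
  gcud≡1⇒unitarilyCoprime 1≤d 1≤r gcud≡1 f f∣∣d f∣∣r =
    subst (f ≤_) gcud≡1 (≤-foldr-⊔ (∈-commonUnitaryDivisors⁺ 1≤d 1≤r f∣∣d f∣∣r))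

  unitarilyCoprime⇒gcud≡1 : ∀ {d r} → 1 ≤ d → 1 ≤ r → UnitarilyCoprime d r → gcud d r ≡ 1
  unitarilyCoprime⇒gcud≡1 {d} {r} 1≤d 1≤r d⊥⊥r = ≤-antisym
    (foldr-⊔-≤ (All.tabulate λ f∈ →
      let f∣∣d , f∣∣r = ∈-commonUnitaryDivisors⁻ 1≤d 1≤r f∈ in d⊥⊥r _ f∣∣d f∣∣r))
    (≤-foldr-⊔ (∈-commonUnitaryDivisors⁺ 1≤d 1≤r (1-unitaryDivisor d) (1-unitaryDivisor r)))

  BiUnitaryDivisor : ℕ → ℕ → Set
  BiUnitaryDivisor d n = Σ ℕ λ r → n ≡ d * r × UnitarilyCoprime d r

  ∈-biUnitaryDivisors⁺ : ∀ {d n} → 1 ≤ n → BiUnitaryDivisor d n → d ∈ biUnitaryDivisors n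
  ∈-biUnitaryDivisors⁺ {d} {n} 1≤n (r , n≡ , d⊥⊥r) =
    ∈-filter⁺ (λ d → gcud d (quot n d) ≟ 1) (∈-divisors⁺ 1≤n (divides r (trans n≡ (*-comm d r))))
      (trans (cong (gcud d) (quot-exact d 1≤d n≡)) (unitarilyCoprime⇒gcud≡1 1≤d 1≤r d⊥⊥r))
    where
    1≤d = proj₁ (factors-positive d r 1≤n n≡)
    1≤r = proj₂ (factors-positive d r 1≤n n≡)

  ∈-biUnitaryDivisors⁻ : ∀ {d n} → 1 ≤ n → d ∈ biUnitaryDivisors n → BiUnitaryDivisor d n
  ∈-biUnitaryDivisors⁻ {d} {n} 1≤n d∈ =
    let d∈divisors , gcud≡1 = ∈-filter⁻ (λ d → gcud d (quot n d) ≟ 1) {xs = divisors n} d∈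
        n≡ = ∣⇒≡*quot 1≤n (∈-divisors⁻ d∈divisors)
        1≤d , 1≤r = factors-positive d (quot n d) 1≤n n≡
    in quot n d , n≡ , gcud≡1⇒unitarilyCoprime 1≤d 1≤r gcud≡1

  biUnitaryDivisors-unique : ∀ n → Unique (biUnitaryDivisors n)
  biUnitaryDivisors-unique n = Unique.filter⁺ (λ d → gcud d (quot n d) ≟ 1) (divisors-unique n)

  length-≤-⊇ : ∀ {A : Set} {xs ys : List A} → Unique xs → (∀ {x} → x ∈ xs → x ∈ ys) → length xs ≤ length ys
  length-≤-⊇ {xs = []}     _              _  = z≤n
  length-≤-⊇ {xs = x ∷ xs} (x∉xs AllPairs.∷ unique) xs⊆ys
    with before , after , refl ← ∈-∃++ (xs⊆ys (here refl)) = begin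
      suc (length xs)                     ≤⟨ s≤s (length-≤-⊇ unique xs⊆rest) ⟩
      suc (length (before ++ after))      ≡⟨ cong suc (length-++ before) ⟩
      suc (length before + length after)  ≡⟨ +-suc (length before) (length after) ⟨
      length before + suc (length after)  ≡⟨ length-++ before ⟨
      length (before ++ x ∷ after)        ∎
    where
    open ≤-Reasoning
    xs⊆rest : ∀ {y} → y ∈ xs → y ∈ before ++ after
    xs⊆rest {y} y∈xs with ∈-++⁻ before (xs⊆ys (there y∈xs))
    ... | inj₁ y∈before         = ∈-++⁺ˡ y∈before
    ... | inj₂ (here refl)      = contradiction refl (All.lookup x∉xs y∈xs)
    ... | inj₂ (there y∈after)  = ∈-++⁺ʳ before y∈after

  map-unique : ∀ {A B : Set} {f : A → B} {xs : List A} → Unique xs →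
               (∀ {x y} → x ∈ xs → y ∈ xs → f x ≡ f y → x ≡ y) → Unique (map f xs)
  map-unique {xs = []}     _ _ = AllPairs.[]
  map-unique {f = f} {xs = x ∷ xs} (x∉xs AllPairs.∷ unique) injective =
    All.tabulate (λ fy∈ fx≡fy → let y , y∈xs , fy≡ = ∈-map⁻ f fy∈ in
      All.lookup x∉xs y∈xs (injective (here refl) (there y∈xs) (trans fx≡fy fy≡)))
    AllPairs.∷ map-unique unique (λ x∈ y∈ → injective (there x∈) (there y∈))

  length-cartesianProduct : ∀ {A B : Set} (xs : List A) (ys : List B) →
                            length (cartesianProduct xs ys) ≡ length xs * length ys
  length-cartesianProduct []       ys = refl
  length-cartesianProduct (x ∷ xs) ys =
    trans (length-++ (map (x ,_) ys)) (cong₂ _+_ (length-map (x ,_) ys) (length-cartesianProduct xs ys))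

  length-image-product : ∀ {A B C : Set} (f : A × B → C) {xs : List A} {ys : List B} {zs : List C} →
    Unique xs → Unique ys → Unique zs →
    (∀ {x y x′ y′} → x ∈ xs → y ∈ ys → x′ ∈ xs → y′ ∈ ys →
       f (x , y) ≡ f (x′ , y′) → (x , y) ≡ (x′ , y′)) →
    (∀ {x y} → x ∈ xs → y ∈ ys → f (x , y) ∈ zs) →
    (∀ {z} → z ∈ zs → Σ A λ x → Σ B λ y → x ∈ xs × y ∈ ys × z ≡ f (x , y)) →
    length zs ≡ length xs * length ys
  length-image-product f {xs} {ys} {zs} xs-unique ys-unique zs-unique injective into onto =
    trans (≤-antisym zs≤image image≤zs) length-image
    where
    image = map f (cartesianProduct xs ys)
    length-image : length image ≡ length xs * length ys
    length-image = trans (length-map f (cartesianProduct xs ys)) (length-cartesianProduct xs ys)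
    image-unique : Unique image
    image-unique = map-unique (Unique.cartesianProduct⁺ xs-unique ys-unique) λ p∈ q∈ →
      let x∈ , y∈ = ∈-cartesianProduct⁻ xs ys p∈
          x′∈ , y′∈ = ∈-cartesianProduct⁻ xs ys q∈
      in injective x∈ y∈ x′∈ y′∈
    zs≤image : length zs ≤ length image
    zs≤image = length-≤-⊇ zs-unique λ z∈ →
      let x , y , x∈ , y∈ , z≡ = onto z∈ in subst (_∈ image) (sym z≡) (∈-map⁺ f (∈-cartesianProduct⁺ x∈ y∈))
    image≤zs : length image ≤ length zs
    image≤zs = length-≤-⊇ image-unique λ z∈ →
      let (x , y) , p∈ , z≡ = ∈-map⁻ f z∈
          x∈ , y∈ = ∈-cartesianProduct⁻ xs ys p∈
      in subst (_∈ zs) (sym z≡) (into x∈ y∈)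

  length-delete : ∀ {x xs} → Unique xs → x ∈ xs → suc (length (filter (λ y → ¬? (y ≟ x)) xs)) ≡ length xs
  length-delete {x} (x∉xs AllPairs.∷ _) (here refl) = cong suc (trans
    (cong length (filter-reject (λ y → ¬? (y ≟ x)) (λ ≢x → ≢x refl)))
    (cong length (filter-all (λ y → ¬? (y ≟ x)) (All.map (λ x≢y y≡x → x≢y (sym y≡x)) x∉xs))))
  length-delete {x} (y∉ys AllPairs.∷ unique) (there x∈ys) = cong suc (trans
    (cong length (filter-accept (λ y → ¬? (y ≟ x)) (All.lookup y∉ys x∈ys)))
    (length-delete unique x∈ys))

  even-or-odd : ∀ a → (Σ ℕ λ h → a ≡ h * 2) ⊎ (a % 2 ≡ 1 × Σ ℕ λ h → a ≡ suc (h * 2))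
  even-or-odd a with a % 2 in remainder | m%n<n a 2
  ... | 0           | _ = inj₁ (a / 2 , trans (m≡m%n+[m/n]*n a 2) (cong (_+ a / 2 * 2) remainder))
  ... | 1           | _ = inj₂ (refl , a / 2 , trans (m≡m%n+[m/n]*n a 2) (cong (_+ a / 2 * 2) remainder))
  ... | suc (suc _) | s≤s (s≤s ())

  odd⇒≢double : ∀ {a} → a % 2 ≡ 1 → ∀ i → 2 * i ≢ a
  odd⇒≢double {a} odd i 2i≡a = 0≢1+n (begin
    0            ≡⟨ m*n%n≡0 i 2 ⟨
    i * 2 % 2    ≡⟨ cong (_% 2) (trans (*-comm i 2) 2i≡a) ⟩
    a % 2        ≡⟨ odd ⟩
    1            ∎)
    where open ≡-Reasoning

  -- The exponents 0 ≤ i ≤ a with 2 * i ≢ a: those of p in the bi-unitary divisors of p ^ a.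
  offCentre : ℕ → List ℕ
  offCentre a = filter (λ i → ¬? (2 * i ≟ a)) (upTo (suc a))

  ∈-offCentre⁺ : ∀ {i a} → i ≤ a → 2 * i ≢ a → i ∈ offCentre a
  ∈-offCentre⁺ {a = a} i≤a 2i≢a = ∈-filter⁺ (λ i → ¬? (2 * i ≟ a)) (∈-upTo⁺ (s≤s i≤a)) 2i≢a

  ∈-offCentre⁻ : ∀ {i a} → i ∈ offCentre a → i ≤ a × 2 * i ≢ a
  ∈-offCentre⁻ {a = a} i∈ =
    let i∈upTo , 2i≢a = ∈-filter⁻ (λ i → ¬? (2 * i ≟ a)) {xs = upTo (suc a)} i∈
    in s≤s⁻¹ (∈-upTo⁻ i∈upTo) , 2i≢a

  offCentre-unique : ∀ a → Unique (offCentre a)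
  offCentre-unique a = Unique.filter⁺ (λ i → ¬? (2 * i ≟ a)) (Unique.upTo⁺ (suc a))

  -- offCentre a has a elements for even a and a + 1 for odd a; either way an even number.
  offCentre-even : ∀ a → 2 ∣ length (offCentre a)
  offCentre-even a with even-or-odd a
  ... | inj₁ (h , a≡h*2) = divides h (begin
    length (offCentre a)
      ≡⟨ cong length (filter-≐ (λ i → ¬? (2 * i ≟ a)) (λ i → ¬? (i ≟ h)) off≐ (upTo (suc a))) ⟩
    length (filter (λ i → ¬? (i ≟ h)) (upTo (suc a)))
      ≡⟨ suc-injective (trans (length-delete (Unique.upTo⁺ (suc a)) h∈) (length-upTo (suc a))) ⟩
    a
      ≡⟨ a≡h*2 ⟩
    h * 2 ∎)
    where
    open ≡-Reasoning
    h∈ : h ∈ upTo (suc a)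
    h∈ = ∈-upTo⁺ (s≤s (subst (h ≤_) (sym a≡h*2) (m≤m*n h 2)))
    off≐ : (λ i → ¬ 2 * i ≡ a) ≐ (λ i → ¬ i ≡ h)
    off≐ = (λ {i} 2i≢a i≡h → 2i≢a (trans (*-comm 2 i) (trans (cong (_* 2) i≡h) (sym a≡h*2))))
         , (λ {i} i≢h 2i≡a → i≢h (*-cancelʳ-≡ i h 2 (trans (*-comm i 2) (trans 2i≡a a≡h*2))))
  ... | inj₂ (odd , h , a≡1+h*2) = divides (suc h) (begin
    length (offCentre a)     ≡⟨ cong length (filter-all (λ i → ¬? (2 * i ≟ a)) {xs = upTo (suc a)}
                                                (All.tabulate λ {i} _ → odd⇒≢double odd i)) ⟩
    length (upTo (suc a))    ≡⟨ length-upTo (suc a) ⟩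
    suc a                    ≡⟨ cong suc a≡1+h*2 ⟩
    suc h * 2                ∎)
    where open ≡-Reasoning

  shared⇒double : ∀ {a i l} → a ≡ i + l → SharedPPower i l → 2 * i ≡ a
  shared⇒double {i = i} a≡ (refl , _) = trans (cong (i +_) (+-identityʳ i)) (sym a≡)

  double⇒shared : ∀ {a i l} → 1 ≤ a → a ≡ i + l → 2 * i ≡ a → SharedPPower i l
  double⇒shared {i = zero}  1≤a _  refl = contradiction 1≤a λ ()
  double⇒shared {i = suc i} _   a≡ 2i≡a =
    +-cancelˡ-≡ (suc i) _ _ (trans (cong (suc i +_) (sym (+-identityʳ (suc i)))) (trans 2i≡a a≡)) , s≤s z≤n

  vanishes⇒¬shared : ∀ {i l} → i ≡ 0 ⊎ l ≡ 0 → ¬ SharedPPower i l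
  vanishes⇒¬shared (inj₁ refl) (_    , ())
  vanishes⇒¬shared (inj₂ refl) (refl , ())

  ¬shared⇒vanishes : ∀ i l → i + l ≤ 2 → ¬ SharedPPower i l → i ≡ 0 ⊎ l ≡ 0
  ¬shared⇒vanishes zero          l             _                 _       = inj₁ refl
  ¬shared⇒vanishes (suc i)       zero          _                 _       = inj₂ refl
  ¬shared⇒vanishes 1             1             _                 ¬shared = contradiction (refl , s≤s z≤n) ¬shared
  ¬shared⇒vanishes 1             (suc (suc l)) (s≤s (s≤s ()))    _
  ¬shared⇒vanishes (suc (suc i)) (suc l)       (s≤s (s≤s sum≤0)) _       =
    contradiction (subst (_≤ 0) (+-suc i l) sum≤0) λ ()

  CoprimeIsUnitary AllUnitarilyCoprime : ℕ → Set
  CoprimeIsUnitary    n = ∀ d r → n ≡ d * r → Coprime d r ⇔ UnitarilyCoprime d r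
  AllUnitarilyCoprime n = ∀ d r → n ≡ d * r → UnitarilyCoprime d r

  module _ {p m} (p-prime : Prime p) (p∤m : ¬ p ∣ m) (1≤m : 1 ≤ m) where

    p^*m-positive : ∀ a → 1 ≤ p ^ a * m
    p^*m-positive a = *-mono-≤ (prime^-positive p-prime a) 1≤m

    split : ∀ a d r → p ^ a * m ≡ d * r → FactorPairSplit p a m d r
    split a d r = splitFactorPair p-prime p∤m 1≤m

    -- (i , e) ↦ p ^ i * e is injective on p-free e; it parametrises the divisors of p ^ a * m.
    pPower : ℕ × ℕ → ℕ
    pPower (i , e) = p ^ i * e

    pPower-injective : ∀ {i e i′ e′} → ¬ p ∣ e → ¬ p ∣ e′ →
                       pPower (i , e) ≡ pPower (i′ , e′) → (i , e) ≡ (i′ , e′)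
    pPower-injective {i} {i′ = i′} p∤e p∤e′ eq with pPart-unique p-prime i i′ p∤e p∤e′ eq
    ... | refl , refl = refl

    -- The unitary divisors of p ^ a * m are the p ^ i * e with i ∈ {0, a}, e a unitary divisor of m.
    τ*-step : ∀ {a} → 1 ≤ a → τ* (p ^ a * m) ≡ 2 * τ* m
    τ*-step {a} 1≤a = length-image-product pPower
      (((<⇒≢ 1≤a) ∷ []) AllPairs.∷ ([] AllPairs.∷ AllPairs.[]))
      (unitaryDivisors-unique m) (unitaryDivisors-unique (p ^ a * m))
      (λ _ e∈ _ e′∈ → pPower-injective (p∤ e∈) (p∤ e′∈)) into onto
      where
      p∤ : ∀ {e} → e ∈ unitaryDivisors m → ¬ p ∣ e
      p∤ e∈ = unitaryDivisor-∤ (∈-unitaryDivisors⁻ 1≤m e∈) p∤m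
      into : ∀ {i e} → i ∈ 0 ∷ a ∷ [] → e ∈ unitaryDivisors m → pPower (i , e) ∈ unitaryDivisors (p ^ a * m)
      into i∈ e∈ = ∈-unitaryDivisors⁺ (p^*m-positive a)
        (unitaryDivisor-local⇐ p-prime p∤m a (choice i∈) (∈-unitaryDivisors⁻ 1≤m e∈))
        where
        choice : ∀ {i} → i ∈ 0 ∷ a ∷ [] → i ≡ 0 ⊎ i ≡ a
        choice (here i≡0)         = inj₁ i≡0
        choice (there (here i≡a)) = inj₂ i≡a
      onto : ∀ {d} → d ∈ unitaryDivisors (p ^ a * m) →
             Σ ℕ λ i → Σ ℕ λ e → i ∈ 0 ∷ a ∷ [] × e ∈ unitaryDivisors m × d ≡ pPower (i , e)
      onto d∈ with unitaryDivisor-local⇒ p-prime p∤m 1≤m (∈-unitaryDivisors⁻ (p^*m-positive a) d∈)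
      ... | i , e , d≡ , choice , e∣∣m = i , e , member choice , ∈-unitaryDivisors⁺ 1≤m e∣∣m , d≡
        where
        member : ∀ {i} → i ≡ 0 ⊎ i ≡ a → i ∈ 0 ∷ a ∷ []
        member (inj₁ i≡0) = here i≡0
        member (inj₂ i≡a) = there (here i≡a)

    biUnitaryDivisor-local⇒ : ∀ {a d} → 1 ≤ a → BiUnitaryDivisor d (p ^ a * m) →
      Σ ℕ λ i → Σ ℕ λ e → i ∈ offCentre a × BiUnitaryDivisor e m × d ≡ p ^ i * e
    biUnitaryDivisor-local⇒ {a} {d} 1≤a (r , n≡ , d⊥⊥r) =
      S.i , S.e , ∈-offCentre⁺ i≤a (proj₁ local ∘ double⇒shared 1≤a S.a≡) , (S.h , S.m≡ , proj₂ local) , S.d≡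
      where
      module S = FactorPairSplit (split a d r n≡)
      local = unitarilyCoprime-local⇒ p-prime S.p∤e S.p∤h S.i S.l (subst₂ UnitarilyCoprime S.d≡ S.r≡ d⊥⊥r)
      i≤a = subst (S.i ≤_) (sym S.a≡) (m≤m+n S.i S.l)

    biUnitaryDivisor-local⇐ : ∀ {a i e} → i ∈ offCentre a → BiUnitaryDivisor e m → BiUnitaryDivisor (p ^ i * e) (p ^ a * m)
    biUnitaryDivisor-local⇐ {a} {i} {e} i∈ (h , m≡ , e⊥⊥h) =
      p ^ l * h , p^*-split p i l e h a≡ m≡ ,
      unitarilyCoprime-local⇐ p-prime (∤-divisor p∤m h m≡) (∤-divisor p∤m e (trans m≡ (*-comm e h)))
        (proj₁ (factors-positive e h 1≤m m≡)) (proj₂ (factors-positive e h 1≤m m≡)) i l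
        (proj₂ (∈-offCentre⁻ i∈) ∘ shared⇒double a≡) e⊥⊥h
      where
      l = a ∸ i
      a≡ : a ≡ i + l
      a≡ = sym (m+[n∸m]≡n (proj₁ (∈-offCentre⁻ i∈)))

    τ**-step : ∀ {a} → 1 ≤ a → τ** (p ^ a * m) ≡ length (offCentre a) * τ** m
    τ**-step {a} 1≤a = length-image-product pPower
      (offCentre-unique a) (biUnitaryDivisors-unique m) (biUnitaryDivisors-unique (p ^ a * m))
      (λ _ e∈ _ e′∈ → pPower-injective (p∤ e∈) (p∤ e′∈))
      (λ i∈ e∈ → ∈-biUnitaryDivisors⁺ (p^*m-positive a)
                   (biUnitaryDivisor-local⇐ {a = a} i∈ (∈-biUnitaryDivisors⁻ 1≤m e∈)))
      onto
      where
      p∤ : ∀ {e} → e ∈ biUnitaryDivisors m → ¬ p ∣ e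
      p∤ e∈ = let h , m≡ , _ = ∈-biUnitaryDivisors⁻ 1≤m e∈ in ∤-divisor p∤m h m≡
      onto : ∀ {d} → d ∈ biUnitaryDivisors (p ^ a * m) →
             Σ ℕ λ i → Σ ℕ λ e → i ∈ offCentre a × e ∈ biUnitaryDivisors m × d ≡ pPower (i , e)
      onto d∈ = let i , e , i∈ , e∣∣m , d≡ = biUnitaryDivisor-local⇒ 1≤a (∈-biUnitaryDivisors⁻ (p^*m-positive a) d∈)
                in i , e , i∈ , ∈-biUnitaryDivisors⁺ 1≤m e∣∣m , d≡

    coprimeIsUnitary-step : ∀ {a} → a ≤ 2 → CoprimeIsUnitary m → CoprimeIsUnitary (p ^ a * m)
    coprimeIsUnitary-step {a} a≤2 hyp d r n≡ = mk⇔ to from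
      where
      module S = FactorPairSplit (split a d r n≡)
      to : Coprime d r → UnitarilyCoprime d r
      to d⊥r = subst₂ UnitarilyCoprime (sym S.d≡) (sym S.r≡)
        (unitarilyCoprime-local⇐ p-prime S.p∤e S.p∤h S.1≤e S.1≤h S.i S.l
           (vanishes⇒¬shared (proj₁ local)) (Equivalence.to (hyp S.e S.h S.m≡) (proj₂ local)))
        where local = coprime-local⇒ p-prime S.i S.l (subst₂ Coprime S.d≡ S.r≡ d⊥r)
      from : UnitarilyCoprime d r → Coprime d r
      from d⊥⊥r = subst₂ Coprime (sym S.d≡) (sym S.r≡)
        (coprime-local⇐ p-prime S.p∤e S.p∤h S.i S.l
           (¬shared⇒vanishes S.i S.l (subst (_≤ 2) S.a≡ a≤2) (proj₁ local))
           (Equivalence.from (hyp S.e S.h S.m≡) (proj₂ local)))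
        where local = unitarilyCoprime-local⇒ p-prime S.p∤e S.p∤h S.i S.l (subst₂ UnitarilyCoprime S.d≡ S.r≡ d⊥⊥r)

    allUnitarilyCoprime-step : ∀ {a} → a % 2 ≡ 1 → AllUnitarilyCoprime m → AllUnitarilyCoprime (p ^ a * m)
    allUnitarilyCoprime-step {a} odd hyp d r n≡ = subst₂ UnitarilyCoprime (sym S.d≡) (sym S.r≡)
      (unitarilyCoprime-local⇐ p-prime S.p∤e S.p∤h S.1≤e S.1≤h S.i S.l
         (odd⇒≢double odd S.i ∘ shared⇒double S.a≡) (hyp S.e S.h S.m≡))
      where module S = FactorPairSplit (split a d r n≡)

  prime-divisor : ∀ n → 2 ≤ n → Σ ℕ λ p → Prime p × p ∣ n
  prime-divisor n 2≤n with factorise n {{>-nonZero (≤-trans (s≤s z≤n) 2≤n)}}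
  ... | record { factors = [] ; isFactorisation = n≡1 } = contradiction n≡1 (>⇒≢ 2≤n)
  ... | record { factors = p ∷ ps ; isFactorisation = n≡ ; factorsPrime = p-prime ∷ _ } =
    p , p-prime , divides (product ps) (trans n≡ (*-comm p (product ps)))

  primePower-induction : (P : ℕ → Set) → P 1 →
    (∀ {p a m} → Prime p → ¬ p ∣ m → 1 ≤ m → 1 ≤ a → P m → P (p ^ a * m)) →
    ∀ n → 1 ≤ n → P n
  primePower-induction P base step = <-rec (λ n → 1 ≤ n → P n) go
    where
    go : ∀ n → (∀ {m} → m < n → 1 ≤ m → P m) → 1 ≤ n → P n
    go n rec 1≤n with n ≟ 1
    ... | yes refl = base
    ... | no n≢1 with p , p-prime , p∣n ← prime-divisor n (≤∧≢⇒< 1≤n (n≢1 ∘ sym)) =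
      subst P (sym n≡) (step p-prime p∤m 1≤m 1≤a (rec m<n 1≤m))
      where
      open PPart (pPart-exists p-prime n 1≤n) renaming (exponent to a; rest to m; x≡ to n≡; p∤rest to p∤m)
      1≤m : 1 ≤ m
      1≤m = proj₂ (factors-positive (p ^ a) m 1≤n n≡)
      1≤a : 1 ≤ a
      1≤a = n≢0⇒n>0 λ a≡0 → p∤m (subst (p ∣_) (trans n≡ (trans (cong (λ k → p ^ k * m) a≡0) (*-identityˡ m))) p∣n)
      m<n : m < n
      m<n = begin-strict
        m          <⟨ m<m*n m (p ^ a) {{>-nonZero 1≤m}} (prime^≥2 p-prime a 1≤a) ⟩
        m * p ^ a  ≡⟨ *-comm m (p ^ a) ⟩
        p ^ a * m  ≡⟨ n≡ ⟨
        n          ∎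
        where open ≤-Reasoning

  -- τ* n divides τ** n: by induction along prime-power splittings, using τ*(p^a m) = 2 τ*(m)
  -- and τ**(p^a m) = |offCentre a| τ**(m) with |offCentre a| even.
  τ*∣τ** : ∀ n → 1 ≤ n → τ* n ∣ τ** n
  τ*∣τ** = primePower-induction (λ n → τ* n ∣ τ** n) ∣-refl step
    where
    step : ∀ {p a m} → Prime p → ¬ p ∣ m → 1 ≤ m → 1 ≤ a → τ* m ∣ τ** m → τ* (p ^ a * m) ∣ τ** (p ^ a * m)
    step {a = a} p-prime p∤m 1≤m 1≤a τ*m∣τ**m = subst₂ _∣_
      (sym (τ*-step p-prime p∤m 1≤m 1≤a)) (sym (τ**-step p-prime p∤m 1≤m 1≤a))
      (*-pres-∣ (offCentre-even a) τ*m∣τ**m)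

  primePowerProduct : List (ℕ × ℕ) → ℕ
  primePowerProduct ps = product (map (λ pa → proj₁ pa ^ proj₂ pa) ps)

  primePowerProduct-positive : ∀ ps → All (Prime ∘ proj₁) ps → 1 ≤ primePowerProduct ps
  primePowerProduct-positive []            []                 = s≤s z≤n
  primePowerProduct-positive ((q , b) ∷ ps) (q-prime ∷ primes) =
    *-mono-≤ (prime^-positive q-prime b) (primePowerProduct-positive ps primes)

  prime∣prime^⇒≡ : ∀ {p q} → Prime p → Prime q → ∀ b → p ∣ q ^ b → p ≡ q
  prime∣prime^⇒≡ p-prime q-prime zero    p∣1   = contradiction (∣1⇒≡1 p∣1) (>⇒≢ (prime≥2 p-prime))
  prime∣prime^⇒≡ {q = q} p-prime q-prime (suc b) p∣q^b with euclidsLemma q (q ^ b) p-prime p∣q^b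
  ... | inj₂ p∣q^b′ = prime∣prime^⇒≡ p-prime q-prime b p∣q^b′
  ... | inj₁ p∣q with prime⇒irreducible q-prime p∣q
  ...   | inj₁ p≡1 = contradiction p≡1 (>⇒≢ (prime≥2 p-prime))
  ...   | inj₂ p≡q = p≡q

  prime∤primePowerProduct : ∀ {p} → Prime p → ∀ ps → All (Prime ∘ proj₁) ps → All (p ≢_) (map proj₁ ps) →
                            ¬ p ∣ primePowerProduct ps
  prime∤primePowerProduct p-prime [] [] [] p∣1 = contradiction (∣1⇒≡1 p∣1) (>⇒≢ (prime≥2 p-prime))
  prime∤primePowerProduct p-prime ((q , b) ∷ ps) (q-prime ∷ primes) (p≢q ∷ p∉ps) p∣
    with euclidsLemma (q ^ b) (primePowerProduct ps) p-prime p∣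
  ... | inj₁ p∣q^b  = p≢q (prime∣prime^⇒≡ p-prime q-prime b p∣q^b)
  ... | inj₂ p∣rest = prime∤primePowerProduct p-prime ps primes p∉ps p∣rest

  factorisation-induction : (P E : ℕ → Set) → P 1 →
    (∀ {p a m} → Prime p → ¬ p ∣ m → 1 ≤ m → E a → P m → P (p ^ a * m)) →
    ∀ {n} ps → IsFactorisation n ps → All (E ∘ proj₂) ps → P n
  factorisation-induction P E base step [] (_ , _ , refl) [] = base
  factorisation-induction P E base step ((p , a) ∷ ps) (p-prime ∷ primes , p∉ps AllPairs.∷ distinct , refl) (Ea ∷ Es) =
    step p-prime (prime∤primePowerProduct p-prime ps primes p∉ps) (primePowerProduct-positive ps primes) Ea
      (factorisation-induction P E base step ps (primes , distinct , refl) Es)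

  filter-≐-on : ∀ {P Q : ℕ → Set} (P? : Decidable P) (Q? : Decidable Q) xs →
                (∀ {x} → x ∈ xs → P x ⇔ Q x) → filter P? xs ≡ filter Q? xs
  filter-≐-on P? Q? []       _  = refl
  filter-≐-on P? Q? (x ∷ xs) P⇔Q with P? x | Q? x
  ... | yes _  | yes _  = cong (x ∷_) (filter-≐-on P? Q? xs (P⇔Q ∘ there))
  ... | no _   | no _   = filter-≐-on P? Q? xs (P⇔Q ∘ there)
  ... | yes Px | no ¬Qx = contradiction (Equivalence.to (P⇔Q (here refl)) Px) ¬Qx
  ... | no ¬Px | yes Qx = contradiction (Equivalence.from (P⇔Q (here refl)) Qx) ¬Px

  unitaryDivisors≡biUnitaryDivisors : ∀ {n} ps → IsFactorisation n ps →
    All (λ pa → proj₂ pa ≡ 1 ⊎ proj₂ pa ≡ 2) ps → 1 ≤ n → unitaryDivisors n ≡ biUnitaryDivisors n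
  unitaryDivisors≡biUnitaryDivisors {n} ps factorisation exponents 1≤n =
    filter-≐-on (λ d → isUnitaryDivisor? d n) (λ d → gcud d (quot n d) ≟ 1) (divisors n) λ {d} d∈ →
      let n≡ = ∣⇒≡*quot 1≤n (∈-divisors⁻ d∈)
          1≤d , 1≤r = factors-positive d (quot n d) 1≤n n≡
          d⊥r⇔d⊥⊥r = coprimeIsUnitary d (quot n d) n≡
      in mk⇔ (λ (_ , gcd≡1) → unitarilyCoprime⇒gcud≡1 1≤d 1≤r
                                 (Equivalence.to d⊥r⇔d⊥⊥r (Coprimality.gcd≡1⇒coprime gcd≡1)))
             (λ gcud≡1 → ∈-divisors⁻ d∈ , Coprimality.coprime⇒gcd≡1
                           (Equivalence.from d⊥r⇔d⊥⊥r (gcud≡1⇒unitarilyCoprime 1≤d 1≤r gcud≡1)))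
    where
    ≤2 : ∀ {a} → a ≡ 1 ⊎ a ≡ 2 → a ≤ 2
    ≤2 (inj₁ refl) = s≤s z≤n
    ≤2 (inj₂ refl) = ≤-refl
    base : CoprimeIsUnitary 1
    base d r 1≡ with refl ← m*n≡1⇒m≡1 d r (sym 1≡) = mk⇔ (λ _ → 1-unitarilyCoprime r) (λ _ {d} → coprime-1ˡ r {d})
    coprimeIsUnitary : CoprimeIsUnitary n
    coprimeIsUnitary = factorisation-induction CoprimeIsUnitary (λ a → a ≡ 1 ⊎ a ≡ 2) base
      (λ {a = a} p-prime p∤m 1≤m a∈ → coprimeIsUnitary-step p-prime p∤m 1≤m {a} (≤2 a∈)) ps factorisation exponents

  biUnitaryDivisors≡divisors : ∀ {n} ps → IsFactorisation n ps →
    All (λ pa → proj₂ pa % 2 ≡ 1) ps → 1 ≤ n → biUnitaryDivisors n ≡ divisors n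
  biUnitaryDivisors≡divisors {n} ps factorisation exponents 1≤n =
    filter-all (λ d → gcud d (quot n d) ≟ 1) (All.tabulate λ {d} d∈ →
      let n≡ = ∣⇒≡*quot 1≤n (∈-divisors⁻ d∈)
          1≤d , 1≤r = factors-positive d (quot n d) 1≤n n≡
      in unitarilyCoprime⇒gcud≡1 1≤d 1≤r (allUnitarilyCoprime d (quot n d) n≡))
    where
    base : AllUnitarilyCoprime 1
    base d r 1≡ with refl ← m*n≡1⇒m≡1 d r (sym 1≡) = 1-unitarilyCoprime r
    allUnitarilyCoprime : AllUnitarilyCoprime n
    allUnitarilyCoprime = factorisation-induction AllUnitarilyCoprime (λ a → a % 2 ≡ 1) base
      (λ {a = a} p-prime p∤m 1≤m → allUnitarilyCoprime-step p-prime p∤m 1≤m {a}) ps factorisation exponents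

open import Data.Nat as ℕ using (ℕ; zero; suc; _≥_; _%_)
open import Data.Nat.Divisibility using (_∣_)
open import Data.Nat.Properties using (*-commutativeSemigroup; +-identityʳ)
open import Algebra.Properties.CommutativeSemigroup *-commutativeSemigroup using (x∙yz≈y∙xz)
open import Data.Integer as ℤ using (ℤ; +_)
open import Data.Integer.Properties using (pos-*)
open import Data.Rational using (_*_; _/_; fromℚᵘ; toℚᵘ)
open import Data.Rational.Properties using (*-zeroʳ; fromℚᵘ-toℚᵘ; fromℚᵘ-cong; toℚᵘ-homo-*; toℚᵘ-fromℚᵘ)
open import Data.Rational.Unnormalised as ℚᵘ using (ℚᵘ; mkℚᵘ; *≡*)
open import Data.Rational.Unnormalised.Properties using (≃-trans) renaming (*-cong to ᵘ*-cong)
open import Data.List using (List; length)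
open import Data.Nat.ListAction using (sum)
open import Data.List.Relation.Unary.All using (All)
open import Data.Product using (_×_; _,_; Σ; proj₂)
open import Data.Sum using (_⊎_)
open import Relation.Binary.PropositionalEquality
open DivisorTheory using (τ*∣τ**; unitaryDivisors≡biUnitaryDivisors; biUnitaryDivisors≡divisors)

-- Scaling the numerator of a fraction by a natural number K multiplies it by the integer K;
-- computed through unnormalised rationals, where multiplication needs no normalisation.
/-scale : ∀ K x s → (+ (K ℕ.* x)) / suc s ≡ ((+ K) / 1) * ((+ x) / suc s)
/-scale K x s = sym (begin
  fromℚᵘ k * fromℚᵘ q                  ≡⟨ fromℚᵘ-toℚᵘ (fromℚᵘ k * fromℚᵘ q) ⟨
  fromℚᵘ (toℚᵘ (fromℚᵘ k * fromℚᵘ q))  ≡⟨ fromℚᵘ-cong product ⟩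
  fromℚᵘ (mkℚᵘ (+ (K ℕ.* x)) s)        ∎)
  where
  open ≡-Reasoning
  k q : ℚᵘ
  k = mkℚᵘ (+ K) 0
  q = mkℚᵘ (+ x) s
  product : toℚᵘ (fromℚᵘ k * fromℚᵘ q) ℚᵘ.≃ mkℚᵘ (+ (K ℕ.* x)) s
  product = ≃-trans (toℚᵘ-homo-* (fromℚᵘ k) (fromℚᵘ q))
    (≃-trans (ᵘ*-cong (toℚᵘ-fromℚᵘ k) (toℚᵘ-fromℚᵘ q))
      (*≡* (cong₂ ℤ._*_ (sym (pos-* K x)) (cong +_ (sym (+-identityʳ (suc s)))))))

frac-scale : ∀ K x s → frac (K ℕ.* x) s ≡ ((+ K) / 1) * frac x s
frac-scale K x zero    = sym (*-zeroʳ ((+ K) / 1))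
frac-scale K x (suc s) = /-scale K x s

theorem6 : (n : ℕ) → n ≥ 1 →
    ((Σ ℤ λ k → H** n ≡ (k / 1) * H₅ n)
     × (Σ ℤ λ k → H₄ n ≡ (k / 1) * H₂ n)
     × (Σ ℤ λ k → H₆ n ≡ (k / 1) * H* n))
    × ((ps : List (ℕ × ℕ)) → IsFactorisation n ps →
        All (λ pa → proj₂ pa ≡ 1 ⊎ proj₂ pa ≡ 2) ps →
        H₃ n ≡ H₁ n × H₅ n ≡ H* n × H₆ n ≡ H** n × H** n ≡ H* n × H₄ n ≡ H₂ n)
    × ((ps : List (ℕ × ℕ)) → IsFactorisation n ps →
        All (λ pa → proj₂ pa % 2 ≡ 1) ps →
        H₅ n ≡ H₂ n × H₆ n ≡ H₁ n × H₃ n ≡ H₄ n × H₄ n ≡ H n)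
theorem6 n n≥1 = (τ**-scaled (σ** n) , τ**-scaled (σ n) , τ**-scaled (σ* n)) , exponentsOneOrTwo , exponentsOdd
  where
  τ**-scaled : ∀ s → Σ ℤ λ k → frac (n ℕ.* τ** n) s ≡ (k / 1) * frac (n ℕ.* τ* n) s
  τ**-scaled s = + K , (begin
    frac (n ℕ.* τ** n) s               ≡⟨ cong (λ t → frac (n ℕ.* t) s) τ**≡ ⟩
    frac (n ℕ.* (K ℕ.* τ* n)) s        ≡⟨ cong (λ t → frac t s) (x∙yz≈y∙xz n K (τ* n)) ⟩
    frac (K ℕ.* (n ℕ.* τ* n)) s        ≡⟨ frac-scale K (n ℕ.* τ* n) s ⟩
    ((+ K) / 1) * frac (n ℕ.* τ* n) s  ∎)
    where
    open ≡-Reasoning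
    open _∣_ (τ*∣τ** n n≥1) renaming (quotient to K; equality to τ**≡)
  exponentsOneOrTwo : (ps : List (ℕ × ℕ)) → IsFactorisation n ps →
    All (λ pa → proj₂ pa ≡ 1 ⊎ proj₂ pa ≡ 2) ps →
    H₃ n ≡ H₁ n × H₅ n ≡ H* n × H₆ n ≡ H** n × H** n ≡ H* n × H₄ n ≡ H₂ n
  exponentsOneOrTwo ps factorisation exponents =
    cong (frac (n ℕ.* τ n)) (sym σ*≡σ**) , cong (frac (n ℕ.* τ* n)) (sym σ*≡σ**) ,
    cong (frac (n ℕ.* τ** n)) σ*≡σ** , cong₂ frac (cong (n ℕ.*_) (sym τ*≡τ**)) (sym σ*≡σ**) ,
    cong (λ t → frac (n ℕ.* t) (σ n)) (sym τ*≡τ**)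
    where
    U≡B = unitaryDivisors≡biUnitaryDivisors ps factorisation exponents n≥1
    σ*≡σ** = cong sum U≡B
    τ*≡τ** = cong length U≡B
  exponentsOdd : (ps : List (ℕ × ℕ)) → IsFactorisation n ps →
    All (λ pa → proj₂ pa % 2 ≡ 1) ps →
    H₅ n ≡ H₂ n × H₆ n ≡ H₁ n × H₃ n ≡ H₄ n × H₄ n ≡ H n
  exponentsOdd ps factorisation exponents =
    cong (frac (n ℕ.* τ* n)) σ**≡σ , cong (λ t → frac (n ℕ.* t) (σ* n)) τ**≡τ ,
    cong₂ frac (cong (n ℕ.*_) (sym τ**≡τ)) σ**≡σ , cong (λ t → frac (n ℕ.* t) (σ n)) τ**≡τ
    where
    B≡D = biUnitaryDivisors≡divisors ps factorisation exponents n≥1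
    σ**≡σ = cong sum B≡D
    τ**≡τ = cong length B≡D
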